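{- If $r \in \mathbb{Z}_{\ge 0}$, then \[ \{s(n);\ 2^r \le n \le 2^{r+1}\} = \{K(\underline{l});\ \underline{l} \in E'_r\}. \]
   Context: The Stern sequence $(s(n))_{n\ge 0}$ is defined by $s(0)=0$, $s(1)=1$, $s(2n)=s(n)$ and $s(2n+1)=s(n)+s(n+1)$ for all $n\ge 0$. The continuants $K_d(X_1,\dotsc,X_d)$ are defined by $K_0 = 1$, $K_1(X_1) = X_1$, and $K_d(X_1,\dotsc,X_d) = X_d K_{d-1}(X_1,\dotsc,X_{d-1}) + K_{d-2}(X_1,\dotsc,X_{d-2})$ for $d\ge 2$; for $\underline{l}=(l_1,\dotsc,l_d)$ write $K(\underline{l}) = K_d(l_1,\dotsc,l_d)$. For $r\in\mathbb{Z}$, $E'_r$ is the set of all tuples $(l_1,\dotsc,l_d)$ with $d\in\mathbb{Z}_{\ge 1}$, $l_1,\dotsc,l_d\in\mathbb{Z}_{\ge 1}$, $l_1=l_d=1$ and $l_1+\dotsb+l_d \le r+1$. -}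

module Defs where

open import Data.Nat using (ℕ; zero; suc; _+_; _*_; _≤_)
open import Data.Bool using (Bool; true; false)
open import Data.Nat.ListAction using (sum)
open import Data.List using (List; []; _∷_; length; reverse; head; last)
open import Data.List.Relation.Unary.All using (All)
open import Data.Maybe using (just)
open import Relation.Binary.PropositionalEquality using (_≡_)

half : ℕ → ℕ
half zero = zero
half (suc zero) = zero
half (suc (suc n)) = suc (half n)

even : ℕ → Bool
even zero = true
even (suc zero) = false
even (suc (suc n)) = even n

-- Stern sequence with fuel; sternF f n is correct whenever n ≤ f
-- (each recursive call is on an argument ≤ half n + 1 < n for n ≥ 2).
sternF : ℕ → ℕ → ℕ
sternF _ zero = 0
sternF _ (suc zero) = 1
sternF zero (suc (suc n)) = 0
sternF (suc f) (suc (suc n)) with even n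
... | true  = sternF f (suc (half n))                                -- n+2 = 2(h+1)
... | false = sternF f (suc (half n)) + sternF f (suc (suc (half n))) -- n+2 = 2(h+1)+1

s : ℕ → ℕ
s n = sternF n n

-- Kr takes the list reversed,
-- i.e. Kr [X_d, X_{d-1}, …, X_1] = K_d(X_1,…,X_d):
-- K_0 = 1, K_1(X_1) = X_1, K_d = X_d K_{d-1}(X_1..X_{d-1}) + K_{d-2}(X_1..X_{d-2}).
Kr : List ℕ → ℕ
Kr [] = 1
Kr (x ∷ []) = x
Kr (x ∷ y ∷ r) = x * Kr (y ∷ r) + Kr r

K : List ℕ → ℕ
K l = Kr (reverse l)

record E′ (r : ℕ) (l : List ℕ) : Set where
  field
    nonempty : 1 ≤ length l
    positive : All (λ x → 1 ≤ x) l
    first≡1  : head l ≡ just 1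
    last≡1   : last l ≡ just 1
    sum≤     : sum l ≤ suc r

{-# OPTIONS --safe #-}
-- The pairs (s n, s (n + 1)) with 2^r ≤ n < 2^(r+1) are exactly the nodes at depth r of the
-- Calkin–Wilf tree, where (a, b) has children (a, a + b) and (a + b, b). Climbing the tree runs
-- the subtractive Euclidean algorithm, so each node is, in some order, the pair of consecutive
-- continuants (K(l), K(l_1, …, l_{d−1})) of a positive tuple with l_1 = 1 and Σ l_i = r + 1;
-- conversely every such tuple occurs at depth Σ l_i − 1, and since left children keep the first
-- entry, K(l) is also a first entry at every greater depth. As (…, x + 1) and (…, x, 1) have the
-- same continuant one may assume l_d = 1, and n = 2^(r+1) only adds s n = 1 = K(1).
module Submission where

open import Defs
open import Data.Nat using (ℕ; zero; suc; _+_; _*_; _≤_; _<_; _≤′_; ≤′-refl; ≤′-step; _^_; z≤n; s≤s; s≤s⁻¹)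
open import Data.Nat.Properties
open import Data.Nat.ListAction using (sum)
open import Data.Nat.ListAction.Properties using (sum-↭)
open import Data.Bool using (true; false)
open import Data.List using (List; []; _∷_; _∷ʳ_; reverse; head; last)
open import Data.List.Properties using (unfold-reverse; reverse-involutive; length-reverse)
open import Data.List.Relation.Unary.All using (All; []; _∷_)
open import Data.List.Relation.Binary.Permutation.Propositional using (↭-sym)
open import Data.List.Relation.Binary.Permutation.Propositional.Properties using (↭-reverse; All-resp-↭)
open import Data.Maybe using (just)
open import Data.Maybe.Properties using (just-injective)
open import Data.Product using (∃; _×_; _,_; proj₁; proj₂)
open import Data.Sum using (inj₁; inj₂)
open import Function.Bundles using (_⇔_; mk⇔)
open import Function.Properties.Equivalence using () renaming (trans to ⇔-trans; sym to ⇔-sym)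
open import Data.Nat.Tactic.RingSolver using (solve-∀)
open import Relation.Binary.PropositionalEquality

half-≤ : ∀ n → half n ≤ n
half-≤ zero = z≤n
half-≤ (suc zero) = z≤n
half-≤ (suc (suc n)) = s≤s (m≤n⇒m≤1+n (half-≤ n))

odd⇒suc-half-≤ : ∀ n → even n ≡ false → suc (half n) ≤ n
odd⇒suc-half-≤ (suc zero) _ = s≤s z≤n
odd⇒suc-half-≤ (suc (suc n)) _ = s≤s (s≤s (half-≤ n))

sternF-stable : ∀ f g n → n ≤ f → n ≤ g → sternF f n ≡ sternF g n
sternF-stable f g zero _ _ = refl
sternF-stable f g (suc zero) _ _ = refl
sternF-stable (suc f) (suc g) (suc (suc n)) (s≤s 1+n≤f) (s≤s 1+n≤g) with even n in n-parity
... | true = sternF-stable f g (suc (half n)) (≤-trans (s≤s (half-≤ n)) 1+n≤f) (≤-trans (s≤s (half-≤ n)) 1+n≤g)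
... | false = cong₂ _+_
  (sternF-stable f g (suc (half n)) (≤-trans (s≤s (half-≤ n)) 1+n≤f) (≤-trans (s≤s (half-≤ n)) 1+n≤g))
  (sternF-stable f g (suc (suc (half n)))
    (≤-trans (s≤s (odd⇒suc-half-≤ n n-parity)) 1+n≤f) (≤-trans (s≤s (odd⇒suc-half-≤ n n-parity)) 1+n≤g))

sternF≡s : ∀ f n → n ≤ f → sternF f n ≡ s n
sternF≡s f n n≤f = sternF-stable f n n n≤f ≤-refl

even-double : ∀ n → even (n + n) ≡ true
even-double zero = refl
even-double (suc n) rewrite +-suc n n = even-double n

even-suc-double : ∀ n → even (suc (n + n)) ≡ false
even-suc-double zero = refl
even-suc-double (suc n) rewrite +-suc n n = even-suc-double n

half-double : ∀ n → half (n + n) ≡ n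
half-double zero = refl
half-double (suc n) rewrite +-suc n n = cong suc (half-double n)

half-suc-double : ∀ n → half (suc (n + n)) ≡ n
half-suc-double zero = refl
half-suc-double (suc n) rewrite +-suc n n = cong suc (half-suc-double n)

s-even-suc : ∀ n → s (suc (suc (n + n))) ≡ s (suc n)
s-even-suc n rewrite even-double n | half-double n =
  sternF≡s (suc (n + n)) (suc n) (s≤s (m≤m+n n n))

s-odd-suc : ∀ n → s (suc (suc (suc (n + n)))) ≡ s (suc n) + s (suc (suc n))
s-odd-suc n rewrite even-suc-double n | half-suc-double n =
  cong₂ _+_ (sternF≡s (suc (suc (n + n))) (suc n) (s≤s (m≤n⇒m≤1+n (m≤m+n n n))))
            (sternF≡s (suc (suc (n + n))) (suc (suc n)) (s≤s (s≤s (m≤m+n n n))))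

s-even : ∀ n → s (n + n) ≡ s n
s-even zero = refl
s-even (suc n) rewrite +-suc n n = s-even-suc n

s-odd : ∀ n → s (suc (n + n)) ≡ s n + s (suc n)
s-odd zero = refl
s-odd (suc n) rewrite +-suc n n = s-odd-suc n

2^-suc : ∀ r → 2 ^ suc r ≡ 2 ^ r + 2 ^ r
2^-suc r = cong (2 ^ r +_) (+-identityʳ (2 ^ r))

s-2^ : ∀ r → s (2 ^ r) ≡ 1
s-2^ zero = refl
s-2^ (suc r) = trans (cong s (2^-suc r)) (trans (s-even (2 ^ r)) (s-2^ r))

record Level (r n : ℕ) : Set where
  constructor level
  field
    lower : 2 ^ r ≤ n
    upper : n < 2 ^ suc r

m+m≤1+n+n⇒m≤n : ∀ {m n} → m + m ≤ suc (n + n) → m ≤ n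
m+m≤1+n+n⇒m≤n {zero} _ = z≤n
m+m≤1+n+n⇒m≤n {suc m} {zero} (s≤s p) rewrite +-suc m m with p
... | ()
m+m≤1+n+n⇒m≤n {suc m} {suc n} (s≤s p) rewrite +-suc m m | +-suc n n with p
... | s≤s q = s≤s (m+m≤1+n+n⇒m≤n q)

level-children : ∀ {r n} → Level r n → Level (suc r) (n + n) × Level (suc r) (suc (n + n))
level-children {r} {n} (level lo hi) = level lower (≤-trans (n≤1+n _) upper) , level (m≤n⇒m≤1+n lower) upper
  where
  lower : 2 ^ suc r ≤ n + n
  lower = subst (_≤ n + n) (sym (2^-suc r)) (+-mono-≤ lo lo)
  upper : suc (suc (n + n)) ≤ 2 ^ suc (suc r)
  upper = subst₂ _≤_ (cong suc (+-suc n n)) (sym (2^-suc (suc r))) (+-mono-≤ hi hi)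

level-parent : ∀ {r q n} → q + q ≤ n → n ≤ suc (q + q) → Level (suc r) n → Level r q
level-parent {r} {q} q+q≤n n≤1+q+q (level lo hi) = level
  (m+m≤1+n+n⇒m≤n (subst (_≤ suc (q + q)) (2^-suc r) (≤-trans lo n≤1+q+q)))
  (m+m≤1+n+n⇒m≤n (subst₂ _≤_ (cong suc (sym (+-suc q q))) (cong suc (2^-suc (suc r)))
                           (≤-trans (s≤s (s≤s q+q≤n)) (s≤s hi))))

data Parity : ℕ → Set where
  even-parity : ∀ q → Parity (q + q)
  odd-parity  : ∀ q → Parity (suc (q + q))

parity : ∀ n → Parity n
parity zero = even-parity 0
parity (suc n) with parity n
... | even-parity q = odd-parity q
... | odd-parity q rewrite sym (+-suc q q) = even-parity (suc q)

data CalkinWilf : ℕ → ℕ → ℕ → Set where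
  root  : CalkinWilf 0 1 1
  left  : ∀ {r a b} → CalkinWilf r a b → CalkinWilf (suc r) a (a + b)
  right : ∀ {r a b} → CalkinWilf r a b → CalkinWilf (suc r) (a + b) b

CalkinWilf-swap : ∀ {r a b} → CalkinWilf r a b → CalkinWilf r b a
CalkinWilf-swap root = root
CalkinWilf-swap (left {r} {a} {b} t) = subst (λ c → CalkinWilf (suc r) c a) (+-comm b a) (right (CalkinWilf-swap t))
CalkinWilf-swap (right {r} {a} {b} t) = subst (CalkinWilf (suc r) b) (+-comm b a) (left (CalkinWilf-swap t))

CalkinWilf-deepen : ∀ {k r a b} → k ≤′ r → CalkinWilf k a b → ∃ λ b′ → CalkinWilf r a b′
CalkinWilf-deepen ≤′-refl t = _ , t
CalkinWilf-deepen (≤′-step k≤r) t = _ , left (proj₂ (CalkinWilf-deepen k≤r t))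

CalkinWilf⇒stern : ∀ {r a b} → CalkinWilf r a b → ∃ λ n → Level r n × s n ≡ a × s (suc n) ≡ b
CalkinWilf⇒stern root = 1 , level (s≤s z≤n) (s≤s (s≤s z≤n)) , refl , refl
CalkinWilf⇒stern (left t) with CalkinWilf⇒stern t
... | n , n∈r , refl , refl =
  n + n , proj₁ (level-children n∈r) , s-even n , s-odd n
CalkinWilf⇒stern (right t) with CalkinWilf⇒stern t
... | n , n∈r , refl , refl =
  suc (n + n) , proj₂ (level-children n∈r) , s-odd n , s-even-suc n

stern⇒CalkinWilf : ∀ r n → Level r n → CalkinWilf r (s n) (s (suc n))
stern⇒CalkinWilf zero (suc zero) _ = root
stern⇒CalkinWilf zero (suc (suc n)) (level _ (s≤s (s≤s ())))
stern⇒CalkinWilf (suc r) n n∈r+1 with parity n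
... | even-parity q = subst₂ (CalkinWilf (suc r)) (sym (s-even q)) (sym (s-odd q))
  (left (stern⇒CalkinWilf r q (level-parent ≤-refl (n≤1+n _) n∈r+1)))
... | odd-parity q = subst₂ (CalkinWilf (suc r)) (sym (s-odd q)) (sym (s-even-suc q))
  (right (stern⇒CalkinWilf r q (level-parent (n≤1+n _) ≤-refl n∈r+1)))

-- K(l_1, …, l_{d−1}), with the convention K_{−1} = 0 that makes Kr-∷ hold for ρ = [].
Kr-tail : List ℕ → ℕ
Kr-tail [] = 0
Kr-tail (_ ∷ ρ) = Kr ρ

Kr-∷ : ∀ x ρ → Kr (x ∷ ρ) ≡ x * Kr ρ + Kr-tail ρ
Kr-∷ x [] = sym (trans (+-identityʳ _) (*-identityʳ x))
Kr-∷ x (_ ∷ _) = refl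

Kr-0∷ : ∀ ρ → Kr (0 ∷ ρ) ≡ Kr-tail ρ
Kr-0∷ [] = refl
Kr-0∷ (_ ∷ _) = refl

Kr-suc∷ : ∀ x ρ → Kr (suc x ∷ ρ) ≡ Kr (x ∷ ρ) + Kr ρ
Kr-suc∷ x ρ = begin
  Kr (suc x ∷ ρ)                ≡⟨ Kr-∷ (suc x) ρ ⟩
  suc x * Kr ρ + Kr-tail ρ      ≡⟨ rearrange (Kr ρ) x (Kr-tail ρ) ⟩
  x * Kr ρ + Kr-tail ρ + Kr ρ   ≡⟨ cong (_+ Kr ρ) (Kr-∷ x ρ) ⟨
  Kr (x ∷ ρ) + Kr ρ             ∎
  where
  open ≡-Reasoning
  rearrange : ∀ k x t → suc x * k + t ≡ x * k + t + k
  rearrange = solve-∀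

-- Reversed tuples (l_d, …, l_1) with positive entries and l_1 = 1; l_d is unconstrained.
data Admissible : List ℕ → Set where
  single : Admissible (1 ∷ [])
  cons   : ∀ x {ρ} → Admissible ρ → Admissible (suc x ∷ ρ)

data ContinuantPair (ρ : List ℕ) : ℕ → ℕ → Set where
  forward  : ContinuantPair ρ (Kr ρ) (Kr-tail ρ)
  backward : ContinuantPair ρ (Kr-tail ρ) (Kr ρ)

ContinuantPair-swap : ∀ {ρ a b} → ContinuantPair ρ a b → ContinuantPair ρ b a
ContinuantPair-swap forward = backward
ContinuantPair-swap backward = forward

ContinuantPair-left : ∀ {ρ a b} → Admissible ρ → ContinuantPair ρ a b →
  ∃ λ ρ′ → Admissible ρ′ × sum ρ′ ≡ suc (sum ρ) × ContinuantPair ρ′ a (a + b)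
ContinuantPair-left {ρ} v forward =
  1 ∷ ρ , cons 0 v , refl , subst (ContinuantPair (1 ∷ ρ) (Kr ρ)) Kr-1∷ backward
  where
  Kr-1∷ : Kr (1 ∷ ρ) ≡ Kr ρ + Kr-tail ρ
  Kr-1∷ = trans (Kr-∷ 1 ρ) (cong (_+ Kr-tail ρ) (*-identityˡ (Kr ρ)))
ContinuantPair-left single backward = 1 ∷ 1 ∷ [] , cons 0 single , refl , backward
ContinuantPair-left (cons x {ρ} v) backward =
  suc (suc x) ∷ ρ , cons (suc x) v , refl ,
  subst (ContinuantPair (suc (suc x) ∷ ρ) (Kr ρ)) (trans (Kr-suc∷ (suc x) ρ) (+-comm _ (Kr ρ))) backward

ContinuantPair-right : ∀ {ρ a b} → Admissible ρ → ContinuantPair ρ a b →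
  ∃ λ ρ′ → Admissible ρ′ × sum ρ′ ≡ suc (sum ρ) × ContinuantPair ρ′ (a + b) b
ContinuantPair-right {a = a} {b} v p with ContinuantPair-left v (ContinuantPair-swap p)
... | ρ′ , v′ , e , p′ = ρ′ , v′ , e , subst (λ c → ContinuantPair ρ′ c b) (+-comm b a) (ContinuantPair-swap p′)

CalkinWilf⇒continuants : ∀ {r a b} → CalkinWilf r a b →
  ∃ λ ρ → Admissible ρ × sum ρ ≡ suc r × ContinuantPair ρ a b
CalkinWilf⇒continuants root = 1 ∷ [] , single , refl , forward
CalkinWilf⇒continuants (left t) with CalkinWilf⇒continuants t
... | ρ , v , e , p with ContinuantPair-left v p
... | ρ′ , v′ , e′ , p′ = ρ′ , v′ , trans e′ (cong suc e) , p′
CalkinWilf⇒continuants (right t) with CalkinWilf⇒continuants t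
... | ρ , v , e , p with ContinuantPair-right v p
... | ρ′ , v′ , e′ , p′ = ρ′ , v′ , trans e′ (cong suc e) , p′

CalkinWilf-right-iterate : ∀ x ρ {k} → CalkinWilf k (Kr-tail ρ) (Kr ρ) →
  CalkinWilf (x + k) (Kr (x ∷ ρ)) (Kr ρ)
CalkinWilf-right-iterate zero ρ t = subst (λ c → CalkinWilf _ c (Kr ρ)) (sym (Kr-0∷ ρ)) t
CalkinWilf-right-iterate (suc x) ρ t =
  subst (λ c → CalkinWilf _ c (Kr ρ)) (sym (Kr-suc∷ x ρ)) (right (CalkinWilf-right-iterate x ρ t))

continuants⇒CalkinWilf : ∀ {ρ} → Admissible ρ → ∃ λ k → sum ρ ≡ suc k × CalkinWilf k (Kr ρ) (Kr-tail ρ)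
continuants⇒CalkinWilf single = 0 , refl , root
continuants⇒CalkinWilf (cons x {ρ} v) with continuants⇒CalkinWilf v
... | k , e , t = suc x + k , trans (cong (suc x +_) e) (cong suc (+-suc x k)) ,
  CalkinWilf-right-iterate (suc x) ρ (CalkinWilf-swap t)

ContinuantValue : ℕ → ℕ → Set
ContinuantValue r m = ∃ λ ρ → Admissible ρ × sum ρ ≤ suc r × Kr ρ ≡ m

ContinuantPair⇒ContinuantValue : ∀ {r ρ a b} → Admissible ρ → sum ρ ≤ suc r → ContinuantPair ρ a b →
  ContinuantValue r a
ContinuantPair⇒ContinuantValue {ρ = ρ} v ≤r forward = ρ , v , ≤r , refl
ContinuantPair⇒ContinuantValue single ≤r backward = 1 ∷ [] , single , ≤r , refl
ContinuantPair⇒ContinuantValue (cons x {ρ} v) ≤r backward = ρ , v , ≤-trans (m≤n+m (sum ρ) (suc x)) ≤r , refl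

stern⇔ContinuantValue : ∀ r m → (∃ λ n → 2 ^ r ≤ n × n ≤ 2 ^ suc r × s n ≡ m) ⇔ ContinuantValue r m
stern⇔ContinuantValue r m = mk⇔ to from
  where
  to : (∃ λ n → 2 ^ r ≤ n × n ≤ 2 ^ suc r × s n ≡ m) → ContinuantValue r m
  to (n , lo , hi , refl) with m≤n⇒m<n∨m≡n hi
  ... | inj₂ refl = 1 ∷ [] , single , s≤s z≤n , sym (s-2^ (suc r))
  ... | inj₁ n<2^r+1 with CalkinWilf⇒continuants (stern⇒CalkinWilf r n (level lo n<2^r+1))
  ... | ρ , v , e , p = ContinuantPair⇒ContinuantValue v (≤-reflexive e) p
  from : ContinuantValue r m → ∃ λ n → 2 ^ r ≤ n × n ≤ 2 ^ suc r × s n ≡ m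
  from (ρ , v , ≤r , refl) with continuants⇒CalkinWilf v
  ... | k , e , t with CalkinWilf-deepen (≤⇒≤′ (s≤s⁻¹ (subst (_≤ suc r) e ≤r))) t
  ... | _ , t′ with CalkinWilf⇒stern t′
  ... | n , level lo hi , sn≡ , _ = n , lo , <⇒≤ hi , sn≡

module _ {A : Set} where

  last-∷ʳ : ∀ (xs : List A) x → last (xs ∷ʳ x) ≡ just x
  last-∷ʳ [] x = refl
  last-∷ʳ (_ ∷ []) x = refl
  last-∷ʳ (_ ∷ y ∷ ys) x = last-∷ʳ (y ∷ ys) x

  last-reverse : ∀ (xs : List A) → last (reverse xs) ≡ head xs
  last-reverse [] = refl
  last-reverse (x ∷ xs) = trans (cong last (unfold-reverse x xs)) (last-∷ʳ (reverse xs) x)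

  head-reverse : ∀ (xs : List A) → head (reverse xs) ≡ last xs
  head-reverse xs = trans (sym (last-reverse (reverse xs))) (cong last (reverse-involutive xs))

  All-reverse : ∀ {P : A → Set} {xs} → All P xs → All P (reverse xs)
  All-reverse {xs = xs} = All-resp-↭ (↭-sym (↭-reverse xs))

sum-reverse : ∀ xs → sum (reverse xs) ≡ sum xs
sum-reverse xs = sum-↭ (↭-reverse xs)

Admissible⇒positive : ∀ {ρ} → Admissible ρ → All (1 ≤_) ρ
Admissible⇒positive single = s≤s z≤n ∷ []
Admissible⇒positive (cons _ v) = s≤s z≤n ∷ Admissible⇒positive v

Admissible⇒last≡1 : ∀ {ρ} → Admissible ρ → last ρ ≡ just 1
Admissible⇒last≡1 single = refl
Admissible⇒last≡1 (cons _ single) = refl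
Admissible⇒last≡1 (cons _ (cons _ v)) = Admissible⇒last≡1 (cons _ v)

positive∧last≡1⇒Admissible : ∀ {ρ} → All (1 ≤_) ρ → last ρ ≡ just 1 → Admissible ρ
positive∧last≡1⇒Admissible {x ∷ []} _ last≡1 rewrite just-injective last≡1 = single
positive∧last≡1⇒Admissible {suc x ∷ _ ∷ _} (_ ∷ ps) last≡1 = cons x (positive∧last≡1⇒Admissible ps last≡1)

Admissible-head≡1 : ∀ {ρ} → Admissible ρ →
  ∃ λ ρ′ → Admissible (1 ∷ ρ′) × sum (1 ∷ ρ′) ≡ sum ρ × Kr (1 ∷ ρ′) ≡ Kr ρ
Admissible-head≡1 single = [] , single , refl , refl
Admissible-head≡1 (cons zero {ρ} v) = ρ , cons 0 v , refl , refl
Admissible-head≡1 (cons (suc y) {ρ} v) = suc y ∷ ρ , cons 0 (cons y v) , refl ,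
  trans (cong (_+ Kr ρ) (*-identityˡ _)) (sym (Kr-suc∷ (suc y) ρ))

E′⇔ContinuantValue : ∀ r m → (∃ λ l → E′ r l × K l ≡ m) ⇔ ContinuantValue r m
E′⇔ContinuantValue r m = mk⇔ to from
  where
  to : (∃ λ l → E′ r l × K l ≡ m) → ContinuantValue r m
  to (l , E , refl) = reverse l ,
    positive∧last≡1⇒Admissible (All-reverse positive) (trans (last-reverse l) first≡1) ,
    subst (_≤ suc r) (sym (sum-reverse l)) sum≤ , refl
    where open E′ E
  from : ContinuantValue r m → ∃ λ l → E′ r l × K l ≡ m
  from (ρ , v , ≤r , refl) with Admissible-head≡1 v
  ... | ρ′ , v′ , e , Kr≡ = reverse (1 ∷ ρ′) , E , trans (cong Kr (reverse-involutive (1 ∷ ρ′))) Kr≡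
    where
    E : E′ r (reverse (1 ∷ ρ′))
    E = record
      { nonempty = subst (1 ≤_) (sym (length-reverse (1 ∷ ρ′))) (s≤s z≤n)
      ; positive = All-reverse (Admissible⇒positive v′)
      ; first≡1  = trans (head-reverse (1 ∷ ρ′)) (Admissible⇒last≡1 v′)
      ; last≡1   = last-reverse (1 ∷ ρ′)
      ; sum≤     = subst (_≤ suc r) (sym (trans (sum-reverse (1 ∷ ρ′)) e)) ≤r
      }

corollary3p2 : (r : ℕ) → (m : ℕ) →
    (∃ λ n → 2 ^ r ≤ n × n ≤ 2 ^ suc r × s n ≡ m) ⇔ (∃ λ (l : List ℕ) → E′ r l × K l ≡ m)
corollary3p2 r m = ⇔-trans (stern⇔ContinuantValue r m) (⇔-sym (E′⇔ContinuantValue r m))
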